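{- Let $n,m,\ell\in\mathbb{N}$. If $f:\mathcal{D}(n)\to\mathcal{D}(m)$ and $g:\mathcal{D}(m)\to\mathcal{D}(\ell)$ are reducing functions, then $g\circ f:\mathcal{D}(n)\to\mathcal{D}(\ell)$ is reducing.
   Context: For $n\in\mathbb{N}$, $\mathcal{D}(n)$ is the set of positive divisors of $n$; $\lambda(n)$ is the least prime factor of $n$ if $n\ge2$, and $\lambda(1)=1$. For $m,n\in\mathbb{N}$, a function $f:\mathcal{D}(n)\to\mathcal{D}(m)$ is reducing if for all $d,d'\in\mathcal{D}(n)$: (a) $f(d)\le d$; (b) $\frac{m/f(d)}{n/d}\le\min\left\{1,\frac{\lambda(m/f(d))}{\lambda(n/d)}\right\}$; (c) if $f(d)=2^if(d')$ for some $i\in\mathbb{Z}$, then $d=2^jd'$ for some $j\in\mathbb{Z}$. -}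

module Defs where

open import Data.Nat using (ℕ; zero; suc; NonZero; _≥_)
import Data.Nat as ℕ
open import Data.Nat.Divisibility using (_∣_)
open import Data.Nat.Primality using (Prime)
open import Data.Integer using (ℤ; +_)
open import Data.Rational using (ℚ; _≤_; _⊓_; 1ℚ)
import Data.Rational as ℚ
open import Data.Product using (Σ; ∃; _×_; proj₁)
open import Relation.Binary.PropositionalEquality using (_≡_)

-- 𝒟(n): the positive divisors of n (for n ≥ 1 every divisor is positive).
𝒟 : ℕ → Set
𝒟 n = Σ ℕ (λ d → d ∣ n)

val : ∀ {n} → 𝒟 n → ℕ
val = proj₁

-- Natural-number quotient a / b, total by returning 0 when b = 0
-- (only ever applied with b a positive divisor of a).
_÷_ : ℕ → ℕ → ℕ
a ÷ zero = 0
a ÷ suc b = a ℕ./ suc b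

-- Rational number a / b for naturals (0 when b = 0; never used with b = 0).
frac : ℕ → ℕ → ℚ
frac a zero = ℚ.0ℚ
frac a (suc b) = (+ a) ℚ./ suc b

IsLeastPrimeFactor : ℕ → ℕ → Set
IsLeastPrimeFactor n p =
  (n ≡ 1 × p ≡ 1) Data.Sum.⊎
  (n ≥ 2 × Prime p × p ∣ n × (∀ q → Prime q → q ∣ n → p ℕ.≤ q))
  where import Data.Sum

-- Pow2Rel i x y  means  x = 2^i · y  (i ∈ ℤ), stated without fractions.
Pow2Rel : ℤ → ℕ → ℕ → Set
Pow2Rel (+ k) x y = x ≡ 2 ℕ.^ k ℕ.* y
Pow2Rel (Data.Integer.-[1+ k ]) x y = 2 ℕ.^ suc k ℕ.* x ≡ y

Reducing : (n m : ℕ) → (𝒟 n → 𝒟 m) → Set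
Reducing n m f =
  (∀ d → val (f d) ℕ.≤ val d)
  × (∀ d → ∀ p q →
       IsLeastPrimeFactor (m ÷ val (f d)) p →
       IsLeastPrimeFactor (n ÷ val d) q →
       frac (m ÷ val (f d)) (n ÷ val d) ≤ (1ℚ ⊓ frac p q))
  × (∀ d d' → (∃ λ (i : ℤ) → Pow2Rel i (val (f d)) (val (f d'))) →
       ∃ λ (j : ℤ) → Pow2Rel j (val d) (val d'))

-- Condition (b) is a bound  C/A ≤ min(1, λ(C)/λ(A))  on the ratio of the
-- codivisors A = n/d and C = ℓ/g(f(d)).  Inserting the intermediate codivisor
-- B = m/f(d), the bounds for f and g say B/A ≤ min(1, λ(B)/λ(A)) and
-- C/B ≤ min(1, λ(C)/λ(B)), and multiplying them gives the bound for g ∘ f.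
module Submission where

open import Defs
open import Data.Nat as ℕ using (ℕ; NonZero; zero; suc; _+_; _*_; s≤s; z≤n; >-nonZero)
import Data.Nat.Properties as ℕ
open import Algebra.Properties.CommutativeSemigroup ℕ.*-commutativeSemigroup using (x∙yz≈yx∙z; x∙yz≈y∙xz)
open import Data.Nat.Divisibility using (_∣_; _∣?_; ∣-refl; ∣⇒≤; 0∣⇒≡0)
open import Data.Nat.DivMod using (m≥n⇒m/n>0)
open import Data.Nat.Primality
  using (Prime; _Rough_; rough∧∣⇒prime; rough∧∣⇒rough; rough⇒≤; ∤⇒rough-suc; 2-rough; prime⇒nonTrivial; prime⇒nonZero)
open import Data.Integer as ℤ using (+_)
import Data.Integer.Properties as ℤ
open import Data.Rational as ℚ using (toℚᵘ; 1ℚ; _⊓_)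
open import Data.Rational.Properties
  using (toℚᵘ-fromℚᵘ; toℚᵘ-mono-≤; toℚᵘ-cancel-≤; ⊓-glb; p≤q⊓r⇒p≤q; p≤q⊓r⇒p≤r)
open import Data.Rational.Unnormalised as ℚᵘ using (mkℚᵘ; *≤*)
import Data.Rational.Unnormalised.Properties as ℚᵘ
open import Data.Product using (∃; ∃-syntax; _×_; _,_; proj₂)
open import Data.Sum using (inj₁; inj₂)
open import Function.Bundles using (_⇔_; mk⇔; module Equivalence)
open import Relation.Nullary using (yes; no)
open import Relation.Nullary.Negation using (contradiction)
open import Relation.Binary.PropositionalEquality using (_≡_; refl; sym; trans; subst₂)
open import Function using (_∘_)

open Equivalence using (to; from)

toℚᵘ-frac : ∀ a b → toℚᵘ (frac a (suc b)) ℚᵘ.≃ mkℚᵘ (+ a) b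
toℚᵘ-frac a b = toℚᵘ-fromℚᵘ (mkℚᵘ (+ a) b)

frac≤frac⇔ : ∀ a b c d → .{{NonZero b}} → .{{NonZero d}} →
             frac a b ℚ.≤ frac c d ⇔ a * d ℕ.≤ c * b
frac≤frac⇔ a (suc b) c (suc d) = mk⇔ ≤⇒*≤* *≤*⇒≤
  where
  ≤⇒*≤* : frac a (suc b) ℚ.≤ frac c (suc d) → a * suc d ℕ.≤ c * suc b
  ≤⇒*≤* a/b≤c/d with ℚᵘ.≤-respˡ-≃ (toℚᵘ-frac a b) (ℚᵘ.≤-respʳ-≃ (toℚᵘ-frac c d) (toℚᵘ-mono-≤ a/b≤c/d))
  ... | *≤* ad≤cb = ℤ.drop‿+≤+ (subst₂ ℤ._≤_ (sym (ℤ.pos-* a (suc d))) (sym (ℤ.pos-* c (suc b))) ad≤cb)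

  *≤*⇒≤ : a * suc d ℕ.≤ c * suc b → frac a (suc b) ℚ.≤ frac c (suc d)
  *≤*⇒≤ ad≤cb = toℚᵘ-cancel-≤
    (ℚᵘ.≤-respˡ-≃ (ℚᵘ.≃-sym (toℚᵘ-frac a b)) (ℚᵘ.≤-respʳ-≃ (ℚᵘ.≃-sym (toℚᵘ-frac c d))
      (*≤* (subst₂ ℤ._≤_ (ℤ.pos-* a (suc d)) (ℤ.pos-* c (suc b)) (ℤ.+≤+ ad≤cb)))))

frac≤1⇔ : ∀ a b → .{{NonZero b}} → frac a b ℚ.≤ 1ℚ ⇔ a ℕ.≤ b
-- frac 1 1 reduces to 1ℚ.
frac≤1⇔ a b = mk⇔
  (λ a/b≤1 → subst₂ ℕ._≤_ (ℕ.*-identityʳ a) (ℕ.*-identityˡ b) (to (frac≤frac⇔ a b 1 1) a/b≤1))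
  (λ a≤b → from (frac≤frac⇔ a b 1 1) (subst₂ ℕ._≤_ (sym (ℕ.*-identityʳ a)) (sym (ℕ.*-identityˡ b)) a≤b))

frac≤1⊓frac⇔ : ∀ c b p r → .{{NonZero b}} → .{{NonZero r}} →
               frac c b ℚ.≤ 1ℚ ⊓ frac p r ⇔ (c ℕ.≤ b × c * r ℕ.≤ p * b)
frac≤1⊓frac⇔ c b p r = mk⇔
  (λ c/b≤ → to (frac≤1⇔ c b) (p≤q⊓r⇒p≤q 1ℚ (frac p r) c/b≤) , to (frac≤frac⇔ c b p r) (p≤q⊓r⇒p≤r 1ℚ (frac p r) c/b≤))
  (λ (c≤b , cr≤pb) → ⊓-glb (from (frac≤1⇔ c b) c≤b) (from (frac≤frac⇔ c b p r) cr≤pb))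

*-cross-≤-trans : ∀ {a b c p q r} → .{{NonZero r}} →
                  c * r ℕ.≤ p * b → b * q ℕ.≤ r * a → c * q ℕ.≤ p * a
*-cross-≤-trans {a} {b} {c} {p} {q} {r} cr≤pb bq≤ra = ℕ.*-cancelˡ-≤ r (begin
  r * (c * q)   ≡⟨ x∙yz≈yx∙z r c q ⟩
  (c * r) * q   ≤⟨ ℕ.*-monoˡ-≤ q cr≤pb ⟩
  (p * b) * q   ≡⟨ ℕ.*-assoc p b q ⟩
  p * (b * q)   ≤⟨ ℕ.*-monoʳ-≤ p bq≤ra ⟩
  p * (r * a)   ≡⟨ x∙yz≈y∙xz p r a ⟩
  r * (p * a)   ∎)
  where open ℕ.≤-Reasoning

frac≤1⊓frac-trans : ∀ {a b c p q r} → .{{NonZero a}} → .{{NonZero b}} → .{{NonZero q}} → .{{NonZero r}} →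
                    frac c b ℚ.≤ 1ℚ ⊓ frac p r → frac b a ℚ.≤ 1ℚ ⊓ frac r q → frac c a ℚ.≤ 1ℚ ⊓ frac p q
frac≤1⊓frac-trans {a} {b} {c} {p} {q} {r} c/b≤ b/a≤ =
  let c≤b , cr≤pb = to (frac≤1⊓frac⇔ c b p r) c/b≤
      b≤a , bq≤ra = to (frac≤1⊓frac⇔ b a r q) b/a≤
  in from (frac≤1⊓frac⇔ c a p q) (ℕ.≤-trans c≤b b≤a , *-cross-≤-trans {a} {b} {c} {p} {q} cr≤pb bq≤ra)

-- Trial division by 2 + j, 3 + j, …, n; the first divisor found is prime and n-rough.
roughPrimeDivisor : ∀ gap j {n} → gap + (2 + j) ≡ n → (2 + j) Rough n →
                    ∃[ p ] Prime p × p ∣ n × p Rough n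
roughPrimeDivisor gap j {n} gap+k≡n rough with 2 + j ∣? n
... | yes k∣n = 2 + j , rough∧∣⇒prime rough k∣n , k∣n , rough
roughPrimeDivisor zero      j refl      rough | no k∤n = contradiction ∣-refl k∤n
roughPrimeDivisor (suc gap) j gap+k≡n rough | no k∤n =
  roughPrimeDivisor gap (suc j) (trans (ℕ.+-suc gap (2 + j)) gap+k≡n) (∤⇒rough-suc k∤n rough)

leastPrimeFactor : ∀ n → .{{NonZero n}} → ∃ (IsLeastPrimeFactor n)
leastPrimeFactor 1 = 1 , inj₁ (refl , refl)
leastPrimeFactor n@(suc (suc k)) with roughPrimeDivisor k 0 (ℕ.+-comm k 2) 2-rough
... | p , p-prime , p∣n , rough = p , inj₂ (s≤s (s≤s z≤n) , p-prime , p∣n , least)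
  where
  least : ∀ q → Prime q → q ∣ n → p ℕ.≤ q
  least q q-prime q∣n = rough⇒≤ {{prime⇒nonTrivial q-prime}} (rough∧∣⇒rough rough q∣n)

isLeastPrimeFactor⇒nonZero : ∀ {n p} → IsLeastPrimeFactor n p → NonZero p
isLeastPrimeFactor⇒nonZero (inj₁ (_ , refl))        = _
isLeastPrimeFactor⇒nonZero (inj₂ (_ , p-prime , _)) = prime⇒nonZero p-prime

÷-nonZero : ∀ n {d} → .{{NonZero n}} → d ∣ n → NonZero (n ÷ d)
÷-nonZero n {zero}  d∣n = contradiction (0∣⇒≡0 d∣n) (ℕ.≢-nonZero⁻¹ n)
÷-nonZero n {suc d} d∣n = >-nonZero (m≥n⇒m/n>0 (∣⇒≤ d∣n))

lemma3p7 : (n m ℓ : ℕ) → .{{NonZero n}} → .{{NonZero m}} → .{{NonZero ℓ}} →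
    (f : 𝒟 n → 𝒟 m) → (g : 𝒟 m → 𝒟 ℓ) →
    Reducing n m f → Reducing m ℓ g → Reducing n ℓ (g ∘ f)
lemma3p7 n m ℓ f g (f-≤ , f-ratio , f-pow2) (g-≤ , g-ratio , g-pow2) =
  (λ d → ℕ.≤-trans (g-≤ (f d)) (f-≤ d)) ,
  (λ d p q λC≡p λA≡q →
    let instance
          A≢0 = ÷-nonZero n (proj₂ d)
          B≢0 = ÷-nonZero m (proj₂ (f d))
          q≢0 = isLeastPrimeFactor⇒nonZero λA≡q
        r , λB≡r = leastPrimeFactor (m ÷ val (f d))
        instance r≢0 = isLeastPrimeFactor⇒nonZero λB≡r
    in frac≤1⊓frac-trans (g-ratio (f d) p r λC≡p λB≡r) (f-ratio d r q λB≡r λA≡q)) ,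
  (λ d d' → f-pow2 d d' ∘ g-pow2 (f d) (f d'))
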